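{- Let $\mathsf{SComp}$ be the nonsymmetric sub-operad of $\mathsf{T}\mathbb{N}_3$ generated by the words $00$, $01$ and $02$. Then the elements of $\mathsf{SComp}$ are exactly the nonempty words over the alphabet $\{0,1,2\}$ that begin with $0$. Moreover, for every $n\ge1$, the elements of $\mathsf{SComp}$ of arity $n$ are in bijection with the segmented compositions of the integer $n$. Finally, $\mathsf{SComp}$ is isomorphic to the nonsymmetric operad generated by three generators $a$, $b$, $c$ of arity two subject to the nine relations $a\circ_1 a = a\circ_2 a$, $b\circ_1 a = a\circ_2 b$, $b\circ_1 b = b\circ_2 a$, $c\circ_1 a = a\circ_2 c$, $c\circ_1 c = c\circ_2 a$, $b\circ_1 c = c\circ_2 c$, $c\circ_1 b = b\circ_2 b$, $a\circ_1 b = b\circ_2 c$, $a\circ_1 c = c\circ_2 b$.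
   Context: $\mathbb{N}_3 = \{0,1,2\}$ denotes the additive monoid of integers modulo $3$. $\mathsf{T}\mathbb{N}_3 := \biguplus_{n\ge1}\mathbb{N}_3^n$ is the set of nonempty words over $\mathbb{N}_3$, a word of length $n$ having arity $n$, with partial compositions $x\circ_i y := (x_1,\dots,x_{i-1}, x_i+y_1,\dots,x_i+y_m, x_{i+1},\dots,x_n)$ (sums modulo $3$) for $x$ of length $n$, $y$ of length $m$, $1\le i\le n$; its unit is the word $0$ of length $1$. The nonsymmetric sub-operad generated by a set $G$ of words is the smallest subset containing $G$ and the unit and closed under all partial compositions $\circ_i$. A segmented composition of $n$ is a nonempty finite sequence of compositions (each a nonempty finite sequence of positive integers) whose parts altogether sum to $n$. The nonsymmetric operad generated by generators subject to relations is the quotient of the free nonsymmetric set-operad on these generators by the smallest operad congruence containing the relations. -}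

module Defs where

open import Level using (0ℓ)
open import Data.Nat using (ℕ; zero; suc; _+_; _∸_; _≤_; _<ᵇ_; NonZero)
open import Data.Nat.DivMod using (_mod_)
open import Data.Fin using (Fin; toℕ)
open import Data.Bool using (if_then_else_)
open import Data.List using (List; []; _∷_; map; _++_; length)
open import Data.List.NonEmpty using (List⁺; _∷_) renaming (map to map⁺; foldr to foldr⁺)
open import Data.Product using (Σ; _×_; _,_; proj₁; ∃)
open import Relation.Binary.PropositionalEquality using (_≡_; refl; sym; trans)
open import Relation.Binary.Bundles using (Setoid)
open import Function.Bundles using (Bijection)

ℕ₃ : Set
ℕ₃ = Fin 3

_+₃_ : ℕ₃ → ℕ₃ → ℕ₃
x +₃ y = (toℕ x + toℕ y) mod 3

Word : Set
Word = List ℕ₃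

-- insertion at a 0-based position k
ins : Word → ℕ → Word → Word
ins []      _       y = []
ins (a ∷ x) zero    y = map (a +₃_) y ++ x
ins (a ∷ x) (suc k) y = a ∷ ins x k y

-- partial composition x ∘ᵢ y, with 1 ≤ i ≤ length x (1-based i)
_∘⟨_⟩_ : Word → ℕ → Word → Word
x ∘⟨ i ⟩ y = ins x (i ∸ 1) y

w0 w1 w2 : ℕ₃
w0 = Data.Fin.zero
w1 = Data.Fin.suc Data.Fin.zero
w2 = Data.Fin.suc (Data.Fin.suc Data.Fin.zero)

data SComp : Word → Set where
  gen00 : SComp (w0 ∷ w0 ∷ [])
  gen01 : SComp (w0 ∷ w1 ∷ [])
  gen02 : SComp (w0 ∷ w2 ∷ [])
  unit  : SComp (w0 ∷ [])
  comp  : ∀ {x y} i → 1 ≤ i → i ≤ length x →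
          SComp x → SComp y → SComp (x ∘⟨ i ⟩ y)

ℕ⁺ : Set
ℕ⁺ = Σ ℕ NonZero

Composition : Set
Composition = List⁺ ℕ⁺

SegmentedComposition : Set
SegmentedComposition = List⁺ Composition

sum⁺ : List⁺ ℕ → ℕ
sum⁺ = foldr⁺ _+_ (λ n → n)

total : SegmentedComposition → ℕ
total s = sum⁺ (map⁺ (λ c → sum⁺ (map⁺ proj₁ c)) s)

-- Setoids of "subsets" (equality = equality of the underlying element,
-- so that membership proofs are irrelevant)

subSetoid : (A : Set) (P : A → Set) → Setoid 0ℓ 0ℓ
subSetoid A P = record
  { Carrier = Σ A P
  ; _≈_ = λ a b → proj₁ a ≡ proj₁ b
  ; isEquivalence = record { refl = refl ; sym = sym ; trans = trans }
  }

SCompArity : ℕ → Setoid 0ℓ 0ℓ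
SCompArity n = subSetoid Word (λ w → length w ≡ n × SComp w)

SegComp : ℕ → Setoid 0ℓ 0ℓ
SegComp n = subSetoid SegmentedComposition (λ s → total s ≡ n)

-- The free nonsymmetric set-operad on three binary generators a, b, c:
-- planar binary trees with internal nodes labelled by generators,
-- composition = grafting at the i-th leaf.

data Gen : Set where
  a b c : Gen

data Tree : Set where
  leaf : Tree
  node : Gen → Tree → Tree → Tree

arity : Tree → ℕ
arity leaf         = 1
arity (node g l r) = arity l + arity r

-- grafting at a 0-based leaf position
graft : Tree → ℕ → Tree → Tree
graft leaf         zero    s = s
graft leaf         (suc _) s = leaf
graft (node g l r) k       s =
  if k <ᵇ arity l then node g (graft l k s) r
                  else node g l (graft r (k ∸ arity l) s)

-- partial composition t ∘ᵢ s, 1 ≤ i ≤ arity t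
_⊚⟨_⟩_ : Tree → ℕ → Tree → Tree
t ⊚⟨ i ⟩ s = graft t (i ∸ 1) s

corolla : Gen → Tree
corolla g = node g leaf leaf

data Rel : Tree → Tree → Set where
  r1 : Rel (corolla a ⊚⟨ 1 ⟩ corolla a) (corolla a ⊚⟨ 2 ⟩ corolla a)
  r2 : Rel (corolla b ⊚⟨ 1 ⟩ corolla a) (corolla a ⊚⟨ 2 ⟩ corolla b)
  r3 : Rel (corolla b ⊚⟨ 1 ⟩ corolla b) (corolla b ⊚⟨ 2 ⟩ corolla a)
  r4 : Rel (corolla c ⊚⟨ 1 ⟩ corolla a) (corolla a ⊚⟨ 2 ⟩ corolla c)
  r5 : Rel (corolla c ⊚⟨ 1 ⟩ corolla c) (corolla c ⊚⟨ 2 ⟩ corolla a)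
  r6 : Rel (corolla b ⊚⟨ 1 ⟩ corolla c) (corolla c ⊚⟨ 2 ⟩ corolla c)
  r7 : Rel (corolla c ⊚⟨ 1 ⟩ corolla b) (corolla b ⊚⟨ 2 ⟩ corolla b)
  r8 : Rel (corolla a ⊚⟨ 1 ⟩ corolla b) (corolla b ⊚⟨ 2 ⟩ corolla c)
  r9 : Rel (corolla a ⊚⟨ 1 ⟩ corolla c) (corolla c ⊚⟨ 2 ⟩ corolla b)

data _≈ᵀ_ : Tree → Tree → Set where
  rel    : ∀ {s t} → Rel s t → s ≈ᵀ t
  ≈refl  : ∀ {t} → t ≈ᵀ t
  ≈sym   : ∀ {s t} → s ≈ᵀ t → t ≈ᵀ s
  ≈trans : ∀ {s t u} → s ≈ᵀ t → t ≈ᵀ u → s ≈ᵀ u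
  ≈comp  : ∀ {s s' t t'} i → 1 ≤ i → i ≤ arity s →
           s ≈ᵀ s' → t ≈ᵀ t' → (s ⊚⟨ i ⟩ t) ≈ᵀ (s' ⊚⟨ i ⟩ t')

-- An isomorphism of nonsymmetric operads (free operad / ≈ᵀ) ≅ SComp:
-- a morphism of operads (well defined on classes, arity-preserving,
-- unit- and composition-preserving, with values in SComp) that is
-- bijective onto SComp. (A bijective operad morphism is an isomorphism.)
record OperadIso : Set where
  field
    φ         : Tree → Word
    φ-wd      : ∀ {s t} → s ≈ᵀ t → φ s ≡ φ t
    φ-SComp   : ∀ t → SComp (φ t)
    φ-arity   : ∀ t → length (φ t) ≡ arity t
    φ-unit    : φ leaf ≡ w0 ∷ []
    φ-comp    : ∀ s t i → 1 ≤ i → i ≤ arity s →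
                φ (s ⊚⟨ i ⟩ t) ≡ (φ s ∘⟨ i ⟩ φ t)
    φ-inj     : ∀ s t → φ s ≡ φ t → s ≈ᵀ t
    φ-surj    : ∀ w → SComp w → ∃ λ t → φ t ≡ w

module Submission where

-- The realisation map φ : Tree → Word sends a node labelled g with
-- subtrees l, r to  φ l ++ (val g + φ r), where val a, val b, val c are
-- 0, 1, 2; it is a morphism of operads (grafting becomes insertion), it
-- respects the nine relations, and its image lies in SComp.
--
-- Each relation rotates a left comb into a right comb,
--   g ∘₁ h  =  h ∘₂ (g ⊖ h)      (⊖ = subtraction in ℕ₃ read as a generator),
-- so every tree is congruent to a right comb  comb gs  with gs a list of
-- generators.  φ (comb gs) is the word 0 g₁ (g₁+g₂) … of prefix sums, and
-- taking successive differences (gaps) inverts it.  Hence φ is injective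
-- modulo the relations and its image is exactly the set of words starting
-- with 0; every word of SComp starts with 0 since the generators and the
-- unit do and insertion preserves the first letter.  Finally, reading the
-- gaps a, b, c as "same part", "new part", "new composition" gives the
-- bijection between arity-n elements and segmented compositions of n.

open import Defs
open import Data.Nat using (ℕ; _≤_)
open import Data.List using (_∷_)
open import Data.Product using (_×_; ∃)
open import Relation.Binary.PropositionalEquality using (_≡_)
open import Function.Bundles using (_⇔_; Bijection)

open import Data.Nat using (zero; suc; _+_; _∸_; _%_; _<ᵇ_; z≤n; s≤s; NonZero)
open import Data.Nat.Properties using (+-assoc; +-comm)
open import Data.Nat.DivMod using (%-distribˡ-+; m%n%n≡m%n)
open import Data.Fin as Fin using (toℕ)
open import Data.Fin.Properties using (toℕ-injective; toℕ-fromℕ<)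
open import Data.Bool using (true; false)
open import Data.List using (List; []; map; _++_; length; replicate)
open import Data.List.NonEmpty using (_∷⁺_) renaming (_∷_ to _∷₊_; map to map⁺)
open import Data.List.Properties using (++-assoc; ++-identityʳ; map-++; length-++; length-map)
open import Data.Product using (Σ; _,_; proj₁)
open import Relation.Binary.PropositionalEquality using (refl; sym; trans; cong; cong₂; subst; module ≡-Reasoning)
open import Function.Bundles using (mk⇔; Inverse)
open import Function.Properties.Inverse using (Inverse⇒Bijection)

pattern 0₃ = Fin.zero
pattern 1₃ = Fin.suc Fin.zero
pattern 2₃ = Fin.suc (Fin.suc Fin.zero)

[m%d+n]%d≡[m+n]%d : ∀ m n d .{{_ : NonZero d}} → (m % d + n) % d ≡ (m + n) % d
[m%d+n]%d≡[m+n]%d m n d = begin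
  (m % d + n) % d             ≡⟨ %-distribˡ-+ (m % d) n d ⟩
  (m % d % d + n % d) % d     ≡⟨ cong (λ k → (k + n % d) % d) (m%n%n≡m%n m d) ⟩
  (m % d + n % d) % d         ≡⟨ sym (%-distribˡ-+ m n d) ⟩
  (m + n) % d                 ∎
  where open ≡-Reasoning

toℕ-+₃ : ∀ x y → toℕ (x +₃ y) ≡ (toℕ x + toℕ y) % 3
toℕ-+₃ x y = toℕ-fromℕ< _

+₃-assoc : ∀ x y z → (x +₃ y) +₃ z ≡ x +₃ (y +₃ z)
+₃-assoc x y z = toℕ-injective (begin
  toℕ ((x +₃ y) +₃ z)            ≡⟨ toℕ-+₃ (x +₃ y) z ⟩
  (toℕ (x +₃ y) + toℕ z) % 3     ≡⟨ cong (λ k → (k + toℕ z) % 3) (toℕ-+₃ x y) ⟩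
  ((toℕ x + toℕ y) % 3 + toℕ z) % 3  ≡⟨ [m%d+n]%d≡[m+n]%d (toℕ x + toℕ y) (toℕ z) 3 ⟩
  (toℕ x + toℕ y + toℕ z) % 3    ≡⟨ cong (_% 3) (+-assoc (toℕ x) (toℕ y) (toℕ z)) ⟩
  (toℕ x + (toℕ y + toℕ z)) % 3  ≡⟨ cong (_% 3) (+-comm (toℕ x) _) ⟩
  (toℕ y + toℕ z + toℕ x) % 3    ≡⟨ sym ([m%d+n]%d≡[m+n]%d (toℕ y + toℕ z) (toℕ x) 3) ⟩
  ((toℕ y + toℕ z) % 3 + toℕ x) % 3  ≡⟨ cong (λ k → (k + toℕ x) % 3) (sym (toℕ-+₃ y z)) ⟩
  (toℕ (y +₃ z) + toℕ x) % 3     ≡⟨ cong (_% 3) (+-comm (toℕ (y +₃ z)) (toℕ x)) ⟩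
  (toℕ x + toℕ (y +₃ z)) % 3     ≡⟨ sym (toℕ-+₃ x (y +₃ z)) ⟩
  toℕ (x +₃ (y +₃ z))            ∎)
  where open ≡-Reasoning

+₃-identityˡ : ∀ x → w0 +₃ x ≡ x
+₃-identityˡ 0₃ = refl
+₃-identityˡ 1₃ = refl
+₃-identityˡ 2₃ = refl

+₃-identityʳ : ∀ x → x +₃ w0 ≡ x
+₃-identityʳ 0₃ = refl
+₃-identityʳ 1₃ = refl
+₃-identityʳ 2₃ = refl

val : Gen → ℕ₃
val a = w0
val b = w1
val c = w2

_⊖_ : ℕ₃ → ℕ₃ → Gen
0₃ ⊖ 0₃ = a
1₃ ⊖ 0₃ = b
2₃ ⊖ 0₃ = c
0₃ ⊖ 1₃ = c
1₃ ⊖ 1₃ = a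
2₃ ⊖ 1₃ = b
0₃ ⊖ 2₃ = b
1₃ ⊖ 2₃ = c
2₃ ⊖ 2₃ = a

+₃-⊖ : ∀ u y → u +₃ val (y ⊖ u) ≡ y
+₃-⊖ 0₃ 0₃ = refl
+₃-⊖ 0₃ 1₃ = refl
+₃-⊖ 0₃ 2₃ = refl
+₃-⊖ 1₃ 0₃ = refl
+₃-⊖ 1₃ 1₃ = refl
+₃-⊖ 1₃ 2₃ = refl
+₃-⊖ 2₃ 0₃ = refl
+₃-⊖ 2₃ 1₃ = refl
+₃-⊖ 2₃ 2₃ = refl

⊖-+₃ : ∀ u g → (u +₃ val g) ⊖ u ≡ g
⊖-+₃ 0₃ a = refl
⊖-+₃ 0₃ b = refl
⊖-+₃ 0₃ c = refl
⊖-+₃ 1₃ a = refl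
⊖-+₃ 1₃ b = refl
⊖-+₃ 1₃ c = refl
⊖-+₃ 2₃ a = refl
⊖-+₃ 2₃ b = refl
⊖-+₃ 2₃ c = refl

shift : ℕ₃ → Word → Word
shift u = map (u +₃_)

shift-identity : ∀ w → shift w0 w ≡ w
shift-identity []      = refl
shift-identity (x ∷ w) = cong₂ _∷_ (+₃-identityˡ x) (shift-identity w)

shift-shift : ∀ u v w → shift u (shift v w) ≡ shift (u +₃ v) w
shift-shift u v []      = refl
shift-shift u v (x ∷ w) = cong₂ _∷_ (sym (+₃-assoc u v x)) (shift-shift u v w)

ins-++ˡ : ∀ x y k z → (k <ᵇ length x) ≡ true → ins (x ++ y) k z ≡ ins x k z ++ y
ins-++ˡ (u ∷ x) y zero    z _ = sym (++-assoc (shift u z) x y)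
ins-++ˡ (u ∷ x) y (suc k) z p = cong (u ∷_) (ins-++ˡ x y k z p)

ins-++ʳ : ∀ x y k z → (k <ᵇ length x) ≡ false → ins (x ++ y) k z ≡ x ++ ins y (k ∸ length x) z
ins-++ʳ []      y k       z _ = refl
ins-++ʳ (u ∷ x) y (suc k) z p = cong (u ∷_) (ins-++ʳ x y k z p)

shift-ins : ∀ u w k z → shift u (ins w k z) ≡ ins (shift u w) k z
shift-ins u []      k       z = refl
shift-ins u (x ∷ w) zero    z =
  trans (map-++ (u +₃_) (shift x z) w) (cong (_++ shift u w) (shift-shift u x z))
shift-ins u (x ∷ w) (suc k) z = cong (u +₃ x ∷_) (shift-ins u w k z)

φ : Tree → Word
φ leaf         = w0 ∷ []
φ (node g l r) = φ l ++ shift (val g) (φ r)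

φ-arity : ∀ t → length (φ t) ≡ arity t
φ-arity leaf         = refl
φ-arity (node g l r) = begin
  length (φ l ++ shift (val g) (φ r))          ≡⟨ length-++ (φ l) ⟩
  length (φ l) + length (shift (val g) (φ r))  ≡⟨ cong (length (φ l) +_) (length-map (val g +₃_) (φ r)) ⟩
  length (φ l) + length (φ r)                  ≡⟨ cong₂ _+_ (φ-arity l) (φ-arity r) ⟩
  arity l + arity r                            ∎
  where open ≡-Reasoning

φ-graft : ∀ t k s → φ (graft t k s) ≡ ins (φ t) k (φ s)
φ-graft leaf zero    s = sym (trans (++-identityʳ _) (shift-identity (φ s)))
φ-graft leaf (suc k) s = refl
φ-graft (node g l r) k s with k <ᵇ arity l in below
... | true  = begin
  φ (graft l k s) ++ shift (val g) (φ r)   ≡⟨ cong (_++ shift (val g) (φ r)) (φ-graft l k s) ⟩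
  ins (φ l) k (φ s) ++ shift (val g) (φ r) ≡⟨ sym (ins-++ˡ (φ l) _ k (φ s) below′) ⟩
  ins (φ (node g l r)) k (φ s)             ∎
  where
  open ≡-Reasoning
  below′ : (k <ᵇ length (φ l)) ≡ true
  below′ = trans (cong (k <ᵇ_) (φ-arity l)) below
... | false = begin
  φ l ++ shift (val g) (φ (graft r (k ∸ arity l) s))
    ≡⟨ cong (λ w → φ l ++ shift (val g) w) (φ-graft r (k ∸ arity l) s) ⟩
  φ l ++ shift (val g) (ins (φ r) (k ∸ arity l) (φ s))
    ≡⟨ cong (φ l ++_) (shift-ins (val g) (φ r) (k ∸ arity l) (φ s)) ⟩
  φ l ++ ins (shift (val g) (φ r)) (k ∸ arity l) (φ s)
    ≡⟨ cong (λ m → φ l ++ ins (shift (val g) (φ r)) (k ∸ m) (φ s)) (sym (φ-arity l)) ⟩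
  φ l ++ ins (shift (val g) (φ r)) (k ∸ length (φ l)) (φ s)
    ≡⟨ sym (ins-++ʳ (φ l) _ k (φ s) (trans (cong (k <ᵇ_) (φ-arity l)) below)) ⟩
  ins (φ (node g l r)) k (φ s) ∎
  where open ≡-Reasoning

φ-comp : ∀ s t i → φ (s ⊚⟨ i ⟩ t) ≡ (φ s ∘⟨ i ⟩ φ t)
φ-comp s t i = φ-graft s (i ∸ 1) t

φ-wd : ∀ {s t} → s ≈ᵀ t → φ s ≡ φ t
φ-wd (rel r1)     = refl
φ-wd (rel r2)     = refl
φ-wd (rel r3)     = refl
φ-wd (rel r4)     = refl
φ-wd (rel r5)     = refl
φ-wd (rel r6)     = refl
φ-wd (rel r7)     = refl
φ-wd (rel r8)     = refl
φ-wd (rel r9)     = refl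
φ-wd ≈refl        = refl
φ-wd (≈sym p)     = sym (φ-wd p)
φ-wd (≈trans p q) = trans (φ-wd p) (φ-wd q)
φ-wd (≈comp {s} {s′} {t} {t′} i _ _ p q) = begin
  φ (s ⊚⟨ i ⟩ t)      ≡⟨ φ-comp s t i ⟩
  φ s ∘⟨ i ⟩ φ t      ≡⟨ cong₂ (λ x y → x ∘⟨ i ⟩ y) (φ-wd p) (φ-wd q) ⟩
  φ s′ ∘⟨ i ⟩ φ t′    ≡⟨ sym (φ-comp s′ t′ i) ⟩
  φ (s′ ⊚⟨ i ⟩ t′)    ∎
  where open ≡-Reasoning

-- The image of φ lies in SComp: node g l r is (g ∘₂ r) ∘₁ l, and φ of a
-- corolla is one of the generators 00, 01, 02.
φ-SComp : ∀ t → SComp (φ t)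
φ-SComp leaf         = unit
φ-SComp (node g l r) =
  subst SComp (sym (φ-comp (node g leaf r) l 1))
    (comp 1 (s≤s z≤n) (s≤s z≤n)
      (subst SComp (sym (φ-comp (corolla g) r 2))
        (comp 2 (s≤s z≤n) (s≤s (s≤s z≤n)) (corolla-SComp g) (φ-SComp r)))
      (φ-SComp l))
  where
  corolla-SComp : ∀ g → SComp (φ (corolla g))
  corolla-SComp a = gen00
  corolla-SComp b = gen01
  corolla-SComp c = gen02

comb : List Gen → Tree
comb []       = leaf
comb (g ∷ gs) = node g leaf (comb gs)

relation : ∀ g h → node g (corolla h) leaf ≈ᵀ node h leaf (corolla (val g ⊖ val h))
relation a a = rel r1
relation b a = rel r2
relation b b = rel r3
relation c a = rel r4
relation c c = rel r5
relation b c = rel r6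
relation c b = rel r7
relation a b = rel r8
relation a c = rel r9

-- node g is a congruence in both subtrees: node g l r = (g ∘₂ r) ∘₁ l.
node-cong : ∀ g {l l′ r r′} → l ≈ᵀ l′ → r ≈ᵀ r′ → node g l r ≈ᵀ node g l′ r′
node-cong g p q =
  ≈comp 1 (s≤s z≤n) (s≤s z≤n) (≈comp 2 (s≤s z≤n) (s≤s (s≤s z≤n)) (≈refl {corolla g}) q) p

-- The relations hold with arbitrary subtrees grafted on the three leaves.
rotate : ∀ g h x y z → node g (node h x y) z ≈ᵀ node h x (node (val g ⊖ val h) y z)
rotate g h x y z =
  ≈comp 1 (s≤s z≤n) (s≤s z≤n)
    (≈comp 2 (s≤s z≤n) (s≤s (s≤s z≤n))
      (≈comp 3 (s≤s z≤n) (s≤s (s≤s (s≤s z≤n))) (relation g h) (≈refl {z}))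
      (≈refl {y}))
    (≈refl {x})

-- Normal form of node g (comb L) (comb R), obtained by rotating g down the
-- spine of comb L.
merge : Gen → List Gen → List Gen → List Gen
merge g []      R = g ∷ R
merge g (h ∷ L) R = h ∷ merge (val g ⊖ val h) L R

merge-sound : ∀ g L R → node g (comb L) (comb R) ≈ᵀ comb (merge g L R)
merge-sound g []      R = ≈refl
merge-sound g (h ∷ L) R =
  ≈trans (rotate g h leaf (comb L) (comb R)) (node-cong h ≈refl (merge-sound (val g ⊖ val h) L R))

norm : Tree → List Gen
norm leaf         = []
norm (node g l r) = merge g (norm l) (norm r)

norm-sound : ∀ t → t ≈ᵀ comb (norm t)
norm-sound leaf         = ≈refl
norm-sound (node g l r) =
  ≈trans (node-cong g (norm-sound l) (norm-sound r)) (merge-sound g (norm l) (norm r))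

path : ℕ₃ → List Gen → Word
path u []       = []
path u (g ∷ gs) = (u +₃ val g) ∷ path (u +₃ val g) gs

steps : ℕ₃ → Word → List Gen
steps u []      = []
steps u (y ∷ v) = (y ⊖ u) ∷ steps y v

steps-path : ∀ u gs → steps u (path u gs) ≡ gs
steps-path u []       = refl
steps-path u (g ∷ gs) = cong₂ _∷_ (⊖-+₃ u g) (steps-path (u +₃ val g) gs)

path-steps : ∀ u v → path u (steps u v) ≡ v
path-steps u []      = refl
path-steps u (y ∷ v) =
  cong₂ _∷_ (+₃-⊖ u y) (trans (cong (λ x → path x (steps y v)) (+₃-⊖ u y)) (path-steps y v))

shift-path : ∀ u v gs → shift u (path v gs) ≡ path (u +₃ v) gs
shift-path u v []       = refl
shift-path u v (g ∷ gs) =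
  cong₂ _∷_ (sym (+₃-assoc u v (val g)))
    (trans (shift-path u (v +₃ val g) gs) (cong (λ x → path x gs) (sym (+₃-assoc u v (val g)))))

length-path : ∀ u gs → length (path u gs) ≡ length gs
length-path u []       = refl
length-path u (g ∷ gs) = cong suc (length-path (u +₃ val g) gs)

φ-comb : ∀ gs → φ (comb gs) ≡ w0 ∷ path w0 gs
φ-comb []       = refl
φ-comb (g ∷ gs) = cong (w0 ∷_) (begin
  shift (val g) (φ (comb gs))            ≡⟨ cong (shift (val g)) (φ-comb gs) ⟩
  shift (val g) (w0 ∷ path w0 gs)        ≡⟨ cong (val g +₃ w0 ∷_) (shift-path (val g) w0 gs) ⟩
  (val g +₃ w0) ∷ path (val g +₃ w0) gs  ≡⟨ cong (λ x → x ∷ path x gs) unit-commutes ⟩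
  path w0 (g ∷ gs)                       ∎)
  where
  open ≡-Reasoning
  unit-commutes : val g +₃ w0 ≡ w0 +₃ val g
  unit-commutes = trans (+₃-identityʳ (val g)) (sym (+₃-identityˡ (val g)))

gaps : Word → List Gen
gaps []      = []
gaps (x ∷ v) = steps x v

gaps-φ-comb : ∀ gs → gaps (φ (comb gs)) ≡ gs
gaps-φ-comb gs = trans (cong gaps (φ-comb gs)) (steps-path w0 gs)

StartsWith0 : Word → Set
StartsWith0 w = ∃ λ v → w ≡ w0 ∷ v

φ-comb-gaps : ∀ {w} → StartsWith0 w → φ (comb (gaps w)) ≡ w
φ-comb-gaps (v , refl) = trans (φ-comb (steps w0 v)) (cong (w0 ∷_) (path-steps w0 v))

length-φ-comb : ∀ gs → length (φ (comb gs)) ≡ suc (length gs)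
length-φ-comb gs = trans (cong length (φ-comb gs)) (cong suc (length-path w0 gs))

-- The normal form of a tree can be read off its word; so φ is injective
-- modulo the relations.
norm-gaps : ∀ t → norm t ≡ gaps (φ t)
norm-gaps t = trans (sym (gaps-φ-comb (norm t))) (cong gaps (sym (φ-wd (norm-sound t))))

φ-injective : ∀ s t → φ s ≡ φ t → s ≈ᵀ t
φ-injective s t e = ≈trans (subst (λ L → s ≈ᵀ comb L) same-norm (norm-sound s)) (≈sym (norm-sound t))
  where
  same-norm : norm s ≡ norm t
  same-norm = trans (norm-gaps s) (trans (cong gaps e) (sym (norm-gaps t)))

ins-StartsWith0 : ∀ k v y → StartsWith0 (ins (w0 ∷ v) k (w0 ∷ y))
ins-StartsWith0 zero    v y = _ , refl
ins-StartsWith0 (suc k) v y = _ , refl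

SComp⇒StartsWith0 : ∀ {w} → SComp w → StartsWith0 w
SComp⇒StartsWith0 gen00 = _ , refl
SComp⇒StartsWith0 gen01 = _ , refl
SComp⇒StartsWith0 gen02 = _ , refl
SComp⇒StartsWith0 unit  = _ , refl
SComp⇒StartsWith0 (comp i _ _ sx sy) with SComp⇒StartsWith0 sx | SComp⇒StartsWith0 sy
... | v , refl | y , refl = ins-StartsWith0 (i ∸ 1) v y

-- Such a word is in the image of φ, which lies in SComp.
StartsWith0⇒SComp : ∀ {w} → StartsWith0 w → SComp w
StartsWith0⇒SComp {w} p = subst SComp (φ-comb-gaps p) (φ-SComp (comb (gaps w)))

-- Reading a gap sequence from the right, starting from the segmented
-- composition (1): a adds 1 to the first part, b opens a new first part,
-- c opens a new first composition.

one : ℕ⁺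
one = 1 , _

bump : SegmentedComposition → SegmentedComposition
bump (((suc p , _) ∷₊ ps) ∷₊ cs) = ((suc (suc p) , _) ∷₊ ps) ∷₊ cs

newPart : SegmentedComposition → SegmentedComposition
newPart (C ∷₊ cs) = (one ∷⁺ C) ∷₊ cs

newComposition : SegmentedComposition → SegmentedComposition
newComposition s = (one ∷₊ []) ∷⁺ s

toSeg : List Gen → SegmentedComposition
toSeg []       = (one ∷₊ []) ∷₊ []
toSeg (a ∷ gs) = bump (toSeg gs)
toSeg (b ∷ gs) = newPart (toSeg gs)
toSeg (c ∷ gs) = newComposition (toSeg gs)

-- Conversely, a part p is written a^(p-1), parts are separated by b and
-- compositions by c; each function prepends its output to a given tail.
partLetters : ℕ⁺ → List Gen → List Gen
partLetters (suc k , _) r = replicate k a ++ r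

mutual
  compLetters : ℕ⁺ → List ℕ⁺ → List Gen → List Gen
  compLetters p ps r = partLetters p (laterParts ps r)

  laterParts : List ℕ⁺ → List Gen → List Gen
  laterParts []       r = r
  laterParts (q ∷ qs) r = b ∷ compLetters q qs r

mutual
  segLetters : Composition → List Composition → List Gen
  segLetters (p ∷₊ ps) Cs = compLetters p ps (laterComps Cs)

  laterComps : List Composition → List Gen
  laterComps []       = []
  laterComps (D ∷ Ds) = c ∷ segLetters D Ds

fromSeg : SegmentedComposition → List Gen
fromSeg (C ∷₊ Cs) = segLetters C Cs

fromSeg-bump : ∀ s → fromSeg (bump s) ≡ a ∷ fromSeg s
fromSeg-bump (((suc p , _) ∷₊ ps) ∷₊ cs) = refl

fromSeg-newPart : ∀ s → fromSeg (newPart s) ≡ b ∷ fromSeg s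
fromSeg-newPart (C ∷₊ cs) = refl

fromSeg-toSeg : ∀ gs → fromSeg (toSeg gs) ≡ gs
fromSeg-toSeg []       = refl
fromSeg-toSeg (a ∷ gs) = trans (fromSeg-bump (toSeg gs)) (cong (a ∷_) (fromSeg-toSeg gs))
fromSeg-toSeg (b ∷ gs) = trans (fromSeg-newPart (toSeg gs)) (cong (b ∷_) (fromSeg-toSeg gs))
fromSeg-toSeg (c ∷ gs) = cong (c ∷_) (fromSeg-toSeg gs)

toSeg-part : ∀ k ps X r → toSeg r ≡ (one ∷₊ ps) ∷₊ X →
             toSeg (replicate k a ++ r) ≡ ((suc k , _) ∷₊ ps) ∷₊ X
toSeg-part zero    ps X r e = e
toSeg-part (suc k) ps X r e = cong bump (toSeg-part k ps X r e)

toSeg-comp : ∀ p ps r X → toSeg r ≡ (one ∷₊ []) ∷₊ X → toSeg (compLetters p ps r) ≡ (p ∷₊ ps) ∷₊ X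
toSeg-comp (suc k , _) []        r X e = toSeg-part k [] X r e
toSeg-comp (suc k , _) (q ∷ qs)  r X e =
  toSeg-part k (q ∷ qs) X (b ∷ compLetters q qs r) (cong newPart (toSeg-comp q qs r X e))

toSeg-seg : ∀ C Cs → toSeg (segLetters C Cs) ≡ C ∷₊ Cs
toSeg-seg (p ∷₊ ps) []       = toSeg-comp p ps [] [] refl
toSeg-seg (p ∷₊ ps) (D ∷ Ds) =
  toSeg-comp p ps (c ∷ segLetters D Ds) (D ∷ Ds) (cong newComposition (toSeg-seg D Ds))

toSeg-fromSeg : ∀ s → toSeg (fromSeg s) ≡ s
toSeg-fromSeg (C ∷₊ Cs) = toSeg-seg C Cs

-- Each letter adds 1 to the total, so toSeg gs is a segmented composition
-- of 1 + length gs.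
sum⁺-suc : ∀ x xs → sum⁺ (suc x ∷₊ xs) ≡ suc (sum⁺ (x ∷₊ xs))
sum⁺-suc x []       = refl
sum⁺-suc x (y ∷ ys) = refl

total-bump : ∀ s → total (bump s) ≡ suc (total s)
total-bump (((suc p , _) ∷₊ ps) ∷₊ cs) = begin
  sum⁺ (sum⁺ (suc (suc p) ∷₊ map proj₁ ps) ∷₊ rest)   ≡⟨ cong (λ m → sum⁺ (m ∷₊ rest)) (sum⁺-suc (suc p) (map proj₁ ps)) ⟩
  sum⁺ (suc (sum⁺ (suc p ∷₊ map proj₁ ps)) ∷₊ rest)   ≡⟨ sum⁺-suc _ rest ⟩
  suc (sum⁺ (sum⁺ (suc p ∷₊ map proj₁ ps) ∷₊ rest))   ∎
  where
  open ≡-Reasoning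
  rest : List ℕ
  rest = map (λ C → sum⁺ (map⁺ proj₁ C)) cs

total-newPart : ∀ s → total (newPart s) ≡ suc (total s)
total-newPart ((p ∷₊ ps) ∷₊ cs) =
  sum⁺-suc (sum⁺ (map⁺ proj₁ (p ∷₊ ps))) (map (λ C → sum⁺ (map⁺ proj₁ C)) cs)

total-toSeg : ∀ gs → total (toSeg gs) ≡ suc (length gs)
total-toSeg []       = refl
total-toSeg (a ∷ gs) = trans (total-bump (toSeg gs)) (cong suc (total-toSeg gs))
total-toSeg (b ∷ gs) = trans (total-newPart (toSeg gs)) (cong suc (total-toSeg gs))
total-toSeg (c ∷ gs) = cong suc (total-toSeg gs)

SComp⇔StartsWith0 : ∀ w → SComp w ⇔ StartsWith0 w
SComp⇔StartsWith0 w = mk⇔ SComp⇒StartsWith0 StartsWith0⇒SComp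

-- An element w of SComp of arity n goes to the segmented composition read
-- from its gaps; the inverse writes the gaps and takes the word of the comb.
-- (For n = 0 both sides are empty, so no hypothesis on n is needed.)
arityInverse : ∀ n → Inverse (SCompArity n) (SegComp n)
arityInverse n = record
  { to        = λ (w , len , sw) → toSeg (gaps w) , trans (total-gaps sw) len
  ; from      = λ (s , tot) → φ (comb (fromSeg s)) , length-from s tot , φ-SComp (comb (fromSeg s))
  ; to-cong   = cong (λ w → toSeg (gaps w))
  ; from-cong = cong (λ s → φ (comb (fromSeg s)))
  ; inverse   = (λ {x} → to-from x) , (λ {x} {y} → from-to x y)
  }
  where
  total-gaps : ∀ {w} → SComp w → total (toSeg (gaps w)) ≡ length w
  total-gaps {w} sw = begin
    total (toSeg (gaps w))             ≡⟨ total-toSeg (gaps w) ⟩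
    suc (length (gaps w))              ≡⟨ sym (length-φ-comb (gaps w)) ⟩
    length (φ (comb (gaps w)))         ≡⟨ cong length (φ-comb-gaps (SComp⇒StartsWith0 sw)) ⟩
    length w                           ∎
    where open ≡-Reasoning

  length-from : ∀ s → total s ≡ n → length (φ (comb (fromSeg s))) ≡ n
  length-from s tot = begin
    length (φ (comb (fromSeg s)))      ≡⟨ length-φ-comb (fromSeg s) ⟩
    suc (length (fromSeg s))           ≡⟨ sym (total-toSeg (fromSeg s)) ⟩
    total (toSeg (fromSeg s))          ≡⟨ cong total (toSeg-fromSeg s) ⟩
    total s                            ≡⟨ tot ⟩
    n                                  ∎
    where open ≡-Reasoning

  to-from : ∀ (x : Σ SegmentedComposition (λ s → total s ≡ n)) {w : Word} →
            w ≡ φ (comb (fromSeg (proj₁ x))) → toSeg (gaps w) ≡ proj₁ x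
  to-from (s , _) refl = trans (cong toSeg (gaps-φ-comb (fromSeg s))) (toSeg-fromSeg s)

  from-to : ∀ (x : Σ Word (λ w → length w ≡ n × SComp w)) (y : Σ SegmentedComposition (λ s → total s ≡ n)) →
            proj₁ y ≡ toSeg (gaps (proj₁ x)) → φ (comb (fromSeg (proj₁ y))) ≡ proj₁ x
  from-to (w , _ , sw) (s , _) refl =
    trans (cong (λ gs → φ (comb gs)) (fromSeg-toSeg (gaps w))) (φ-comb-gaps (SComp⇒StartsWith0 sw))

φ-iso : OperadIso
φ-iso = record
  { φ       = φ
  ; φ-wd    = φ-wd
  ; φ-SComp = φ-SComp
  ; φ-arity = φ-arity
  ; φ-unit  = refl
  ; φ-comp  = λ s t i _ _ → φ-comp s t i
  ; φ-inj   = φ-injective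
  ; φ-surj  = λ w sw → comb (gaps w) , φ-comb-gaps (SComp⇒StartsWith0 sw)
  }

mainTheorem9 : (∀ (w : Word) → SComp w ⇔ (∃ λ v → w ≡ w0 ∷ v))
    × (∀ (n : ℕ) → 1 ≤ n → Bijection (SCompArity n) (SegComp n))
    × OperadIso
mainTheorem9 = SComp⇔StartsWith0 , (λ n _ → Inverse⇒Bijection (arityInverse n)) , φ-iso
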